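{- For each positive integer $n$, $s_n=3n+2\sigma(n)$, where $\sigma(n)$ denotes the sum of the $M$-digits of $n$.
   Context: Sequence $s_n$: let $A_1=(5)$ and for $k\ge2$ let $A_k$ be the concatenation $A_{k-1},A_{k-1},(1)$; $A$ is the limiting infinite list; $a_0=0$, $a_n$ is the $n$th entry of $A$ for $n\ge1$, and $s_n=a_0+\cdots+a_n$. For $i\ge1$ let $M_i=2^i-1$. $M$-expansion of a positive integer $n$: let $\ell=\max\{i:n\ge M_i\}$ and write $n=M_\ell+r$ with $0\le r\le M_\ell$; if $r=0$ stop with $n=M_\ell$; if $r=M_\ell$ stop with $n=2M_\ell$; otherwise continue with $r$. This gives $n=\varepsilon_1M_1+\cdots+\varepsilon_\ell M_\ell$ with $\varepsilon_i\in\{0,1,2\}$; the $\varepsilon_i$ are the $M$-digits of $n$, and $\sigma(n)=\varepsilon_1+\cdots+\varepsilon_\ell$. -}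

module Defs where

open import Data.Nat using (ℕ; zero; suc; _+_; _∸_; _^_; _≤?_; _≟_)
open import Data.List using (List; []; _∷_; _++_; [_]; map; upTo; filter; length)
open import Relation.Nullary using (yes; no)
open import Data.Nat.ListAction using (sum)

-- A_k  (k ≥ 1): A_1 = (5), A_k = A_{k-1} ++ A_{k-1} ++ (1).  (A 0 is an unused dummy.)
A : ℕ → List ℕ
A zero = []
A (suc zero) = 5 ∷ []
A (suc (suc k)) = A (suc k) ++ A (suc k) ++ [ 1 ]

nth : List ℕ → ℕ → ℕ
nth [] _ = 0
nth (x ∷ xs) zero = x
nth (x ∷ xs) (suc i) = nth xs i

-- a_0 = 0; for n ≥ 1, a_n is the n-th (1-based) entry of the limit list A.
-- Each A_k is a prefix of A_{k+1} and |A_n| = 2^n - 1 ≥ n, so the n-th entry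
-- of the limit list equals the n-th entry of A_n.
a : ℕ → ℕ
a zero = 0
a (suc m) = nth (A (suc m)) m

s : ℕ → ℕ
s zero = a zero
s (suc n) = s n + a (suc n)

M : ℕ → ℕ
M i = 2 ^ i ∸ 1

-- ℓ(n) = max { i ≥ 1 : n ≥ M_i }  (any such i satisfies i ≤ n, so search downward from n)
ellFrom : ℕ → ℕ → ℕ
ellFrom n zero = 0
ellFrom n (suc i) with M (suc i) ≤? n
... | yes _ = suc i
... | no _  = ellFrom n i

ell : ℕ → ℕ
ell n = ellFrom n n

-- The M-expansion algorithm, recording the indices ℓ used (with multiplicity).
-- Fuel guarantees termination; fuel n suffices for n since the remainder strictly decreases.
expandF : ℕ → ℕ → List ℕ
expandF zero n = []
expandF (suc f) zero = []
expandF (suc f) (suc m) with ell (suc m)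
... | l with (suc m ∸ M l) ≟ 0
...   | yes _ = l ∷ []
...   | no _ with (suc m ∸ M l) ≟ M l
...     | yes _ = l ∷ l ∷ []
...     | no _  = l ∷ expandF f (suc m ∸ M l)

expand : ℕ → List ℕ
expand n = expandF n n

digit : ℕ → ℕ → ℕ
digit n i = length (filter (λ j → j ≟ i) (expand n))

σ : ℕ → ℕ
σ n = sum (map (λ i → digit n (suc i)) (upTo (ell n)))

module Submission where

open import Defs
open import Data.Nat using (ℕ; zero; suc; _+_; _*_; _∸_; _^_; _≤_; _<_; _≤′_; ≤′-refl; ≤′-step; z≤n; s≤s; s≤s⁻¹; _≟_; _≤?_)
open import Data.Nat.Properties
open import Data.Nat.ListAction using (sum)
open import Data.Nat.ListAction.Properties using (sum-++)
open import Data.Nat.Tactic.RingSolver using (solve-∀)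
open import Data.List using (List; []; _∷_; _++_; [_]; take; length; filter; map; upTo)
open import Data.List.Properties using (length-++; take-all; map-++; map-cong; upTo-∷ʳ; filter-accept; filter-reject)
open import Data.List.Relation.Unary.All as All using (All; []; _∷_)
open import Data.Product using (_×_; _,_; map₂)
open import Data.Sum using (_⊎_; inj₁; inj₂)
open import Data.Bool using (true; false)
open import Function using (_∘_)
open import Relation.Nullary using (yes; no; does)
open import Relation.Nullary.Negation using (contradiction)
open import Relation.Binary.PropositionalEquality hiding ([_])
open ≡-Reasoning

-- A_{k+1} = A_k A_k (1) has length M_{k+1} and sum 3M_{k+1} + 2, and each A_k is a
-- prefix of the limit, so s_n is the sum of the first n entries of any A_k with
-- n ≤ M_k.  Reading off the block structure of A_{j+2} gives
-- s(M_{j+1} + r) = s(M_{j+1}) + s(r) = 3M_{j+1} + 2 + s(r) for r ≤ M_{j+1}: every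
-- step n = M_ℓ + r of the M-expansion contributes 3M_ℓ + 2, and σ(n) counts the steps.

M-suc : ∀ k → M (suc k) ≡ suc (M k + M k)
M-suc k with 2 ^ k | m^n>0 2 k
... | suc q | _ = trans (+-suc q (q + 0)) (cong (λ t → suc (q + t)) (+-identityʳ q))

n≤M : ∀ n → n ≤ M n
n≤M zero    = z≤n
n≤M (suc n) rewrite M-suc n = s≤s (≤-trans (n≤M n) (m≤m+n (M n) (M n)))

M-mono-≤ : ∀ {i j} → i ≤ j → M i ≤ M j
M-mono-≤ i≤j = ∸-monoˡ-≤ 1 (^-monoʳ-≤ 2 i≤j)

∸M≤M : ∀ k {n} → n < M (suc k) → n ∸ M k ≤ M k
∸M≤M k {n} n<M = m≤n+o⇒m∸n≤o n (M k) (s≤s⁻¹ (subst (n <_) (M-suc k) n<M))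

length-A : ∀ k → length (A k) ≡ M k
length-A zero          = refl
length-A (suc zero)    = refl
length-A (suc (suc k)) = begin
  length (X ++ X ++ [ 1 ])       ≡⟨ length-++ X ⟩
  length X + length (X ++ [ 1 ]) ≡⟨ cong (length X +_) (length-++ X) ⟩
  length X + (length X + 1)      ≡⟨ cong (λ t → t + (t + 1)) (length-A (suc k)) ⟩
  M (suc k) + (M (suc k) + 1)    ≡⟨ regroup (M (suc k)) ⟩
  suc (M (suc k) + M (suc k))    ≡⟨ sym (M-suc (suc k)) ⟩
  M (suc (suc k))                ∎
  where
  X = A (suc k)
  regroup : ∀ m → m + (m + 1) ≡ suc (m + m)
  regroup = solve-∀

take-length-++ : ∀ {T : Set} (xs ys : List T) r → take (length xs + r) (xs ++ ys) ≡ xs ++ take r ys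
take-length-++ []       ys r = refl
take-length-++ (x ∷ xs) ys r = cong (x ∷_) (take-length-++ xs ys r)

take-++-≤ : ∀ {T : Set} (xs ys : List T) {r} → r ≤ length xs → take r (xs ++ ys) ≡ take r xs
take-++-≤ xs       ys {zero}  _          = refl
take-++-≤ (x ∷ xs) ys {suc r} (s≤s r≤xs) = cong (x ∷_) (take-++-≤ xs ys r≤xs)

nth-++ˡ : ∀ (xs ys : List ℕ) {m} → m < length xs → nth (xs ++ ys) m ≡ nth xs m
nth-++ˡ (x ∷ xs) ys {zero}  _   = refl
nth-++ˡ (x ∷ xs) ys {suc m} m<xs = nth-++ˡ xs ys (s≤s⁻¹ m<xs)

-- nth returns 0 past the end of the list, so no length hypothesis is needed.
sum-take-suc : ∀ (xs : List ℕ) n → sum (take (suc n) xs) ≡ sum (take n xs) + nth xs n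
sum-take-suc []       zero    = refl
sum-take-suc []       (suc n) = refl
sum-take-suc (x ∷ xs) zero    = +-identityʳ x
sum-take-suc (x ∷ xs) (suc n) =
  trans (cong (x +_) (sum-take-suc xs n)) (sym (+-assoc x _ (nth xs n)))

sum[A]≡3M+2 : ∀ k → sum (A (suc k)) ≡ 3 * M (suc k) + 2
sum[A]≡3M+2 zero    = refl
sum[A]≡3M+2 (suc k) = begin
  sum (X ++ X ++ [ 1 ])           ≡⟨ sum-++ X _ ⟩
  sum X + sum (X ++ [ 1 ])        ≡⟨ cong (sum X +_) (sum-++ X [ 1 ]) ⟩
  sum X + (sum X + (1 + 0))       ≡⟨ cong (λ t → t + (t + 1)) (sum[A]≡3M+2 k) ⟩
  3 * m + 2 + (3 * m + 2 + 1)     ≡⟨ regroup m ⟩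
  3 * suc (m + m) + 2             ≡⟨ cong (λ t → 3 * t + 2) (sym (M-suc (suc k))) ⟩
  3 * M (suc (suc k)) + 2         ∎
  where
  X = A (suc k)
  m = M (suc k)
  regroup : ∀ m → 3 * m + 2 + (3 * m + 2 + 1) ≡ 3 * suc (m + m) + 2
  regroup = solve-∀

nth-A-suc : ∀ k {m} → m < M k → nth (A (suc k)) m ≡ nth (A k) m
nth-A-suc (suc k) {m} m<M = nth-++ˡ (A (suc k)) _ (subst (m <_) (sym (length-A (suc k))) m<M)

nth-A-mono : ∀ {j k m} → m < M j → j ≤′ k → nth (A k) m ≡ nth (A j) m
nth-A-mono m<M ≤′-refl                 = refl
nth-A-mono m<M (≤′-step {k} j≤′k) =
  trans (nth-A-suc k (<-≤-trans m<M (M-mono-≤ (≤′⇒≤ j≤′k)))) (nth-A-mono m<M j≤′k)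

nth-A : ∀ k {m} → m < M k → nth (A k) m ≡ a (suc m)
nth-A k {m} m<M with ≤-total (suc m) k
... | inj₁ 1+m≤k = nth-A-mono (n≤M (suc m)) (≤⇒≤′ 1+m≤k)
... | inj₂ k≤1+m = sym (nth-A-mono m<M (≤⇒≤′ k≤1+m))

s≡sum-take-A : ∀ k n → n ≤ M k → s n ≡ sum (take n (A k))
s≡sum-take-A k zero    _   = refl
s≡sum-take-A k (suc n) n<M = begin
  s n + a (suc n)                      ≡⟨ cong₂ _+_ (s≡sum-take-A k n (<⇒≤ n<M)) (sym (nth-A k n<M)) ⟩
  sum (take n (A k)) + nth (A k) n     ≡⟨ sym (sum-take-suc (A k) n) ⟩
  sum (take (suc n) (A k))             ∎

s[M]≡sum[A] : ∀ k → s (M k) ≡ sum (A k)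
s[M]≡sum[A] k = trans (s≡sum-take-A k (M k) ≤-refl) (cong sum (take-all (M k) (A k) (≤-reflexive (length-A k))))

s[M+r]≡s[M]+s[r] : ∀ j {r} → r ≤ M (suc j) → s (M (suc j) + r) ≡ s (M (suc j)) + s r
s[M+r]≡s[M]+s[r] j {r} r≤m = begin
  s (m + r)                                  ≡⟨ s≡sum-take-A (suc (suc j)) (m + r) m+r≤ ⟩
  sum (take (m + r) (X ++ X ++ [ 1 ]))        ≡⟨ cong (λ t → sum (take (t + r) (X ++ X ++ [ 1 ]))) (sym (length-A (suc j))) ⟩
  sum (take (length X + r) (X ++ X ++ [ 1 ])) ≡⟨ cong sum (take-length-++ X _ r) ⟩
  sum (X ++ take r (X ++ [ 1 ]))              ≡⟨ sum-++ X _ ⟩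
  sum X + sum (take r (X ++ [ 1 ]))           ≡⟨ cong₂ _+_ (sym (s[M]≡sum[A] (suc j))) (cong sum (take-++-≤ X [ 1 ] r≤X)) ⟩
  s m + sum (take r X)                        ≡⟨ cong (s m +_) (sym (s≡sum-take-A (suc j) r r≤m)) ⟩
  s m + s r                                   ∎
  where
  X = A (suc j)
  m = M (suc j)
  r≤X : r ≤ length X
  r≤X = subst (r ≤_) (sym (length-A (suc j))) r≤m
  m+r≤ : m + r ≤ M (suc (suc j))
  m+r≤ = subst (m + r ≤_) (sym (M-suc (suc j))) (m≤n⇒m≤1+n (+-monoʳ-≤ m r≤m))

s[M+r]≡3M+2+s[r] : ∀ j {r} → r ≤ M (suc j) → s (M (suc j) + r) ≡ 3 * M (suc j) + 2 + s r
s[M+r]≡3M+2+s[r] j r≤m = trans (s[M+r]≡s[M]+s[r] j r≤m) (cong (_+ _) (trans (s[M]≡sum[A] (suc j)) (sum[A]≡3M+2 j)))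

M-ellFrom-≤ : ∀ n k → M (ellFrom n k) ≤ n
M-ellFrom-≤ n zero = z≤n
M-ellFrom-≤ n (suc k) with M (suc k) ≤? n
... | yes Mk≤n = Mk≤n
... | no  _    = M-ellFrom-≤ n k

≤-ellFrom : ∀ n k {x} → x ≤ k → M x ≤ n → x ≤ ellFrom n k
≤-ellFrom n zero    x≤k _ = x≤k
≤-ellFrom n (suc k) x≤k Mx≤n with M (suc k) ≤? n
... | yes _    = x≤k
... | no  Mk≰n with m≤n⇒m<n∨m≡n x≤k
...   | inj₁ x<1+k = ≤-ellFrom n k (s≤s⁻¹ x<1+k) Mx≤n
...   | inj₂ refl  = contradiction Mx≤n Mk≰n

M-ell-≤ : ∀ n → M (ell n) ≤ n
M-ell-≤ n = M-ellFrom-≤ n n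

≤-ell : ∀ {n x} → M x ≤ n → x ≤ ell n
≤-ell {n} {x} Mx≤n = ≤-ellFrom n n (≤-trans (n≤M x) Mx≤n) Mx≤n

<-M-suc-ell : ∀ n → n < M (suc (ell n))
<-M-suc-ell n = ≰⇒> (λ M≤n → 1+n≰n (≤-ell M≤n))

-- ds lists the indices of the summands M_i of n with multiplicity, leading one first.
-- Maximality of the leading index is not recorded: s n = 3n + 2·|ds| holds for
-- every such decomposition.
data Expansion : ℕ → List ℕ → Set where
  []   : Expansion 0 []
  step : ∀ {n j r ds} → n ≡ M (suc j) + r → r ≤ M (suc j) → Expansion r ds →
         Expansion n (suc j ∷ ds)

s-Expansion : ∀ {n ds} → Expansion n ds → s n ≡ 3 * n + 2 * length ds
s-Expansion [] = refl
s-Expansion (step {j = j} {r} {ds} refl r≤m e) = begin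
  s (M (suc j) + r)                                   ≡⟨ s[M+r]≡3M+2+s[r] j r≤m ⟩
  3 * M (suc j) + 2 + s r                             ≡⟨ cong (3 * M (suc j) + 2 +_) (s-Expansion e) ⟩
  3 * M (suc j) + 2 + (3 * r + 2 * length ds)         ≡⟨ regroup (M (suc j)) r (length ds) ⟩
  3 * (M (suc j) + r) + 2 * suc (length ds)           ∎
  where
  regroup : ∀ m r k → 3 * m + 2 + (3 * r + 2 * k) ≡ 3 * (m + r) + 2 * suc k
  regroup = solve-∀

Expansion-bounds : ∀ {n ds} → Expansion n ds → All (λ i → 1 ≤ i × M i ≤ n) ds
Expansion-bounds [] = []
Expansion-bounds (step {r = r} refl _ e) =
  (s≤s z≤n , m≤m+n _ r) ∷ All.map (map₂ (λ Mi≤r → ≤-trans Mi≤r (m≤n+m r _))) (Expansion-bounds e)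

step-∸ : ∀ {n j ds} → M (suc j) ≤ n → n < M (suc (suc j)) →
         Expansion (n ∸ M (suc j)) ds → Expansion n (suc j ∷ ds)
step-∸ {j = j} M≤n n<M = step (sym (m+[n∸m]≡n M≤n)) (∸M≤M (suc j) n<M)

expandF-Expansion : ∀ f n → n ≤ f → Expansion n (expandF f n)
expandF-Expansion zero    zero    _ = []
expandF-Expansion (suc f) zero    _ = []
expandF-Expansion (suc f) (suc m) (s≤s m≤f)
  -- the second component, 1 ≤ ell (suc m), excludes ell (suc m) = 0
  with ell (suc m) | ≤-ell {suc m} {1} (s≤s z≤n) | M-ell-≤ (suc m) | <-M-suc-ell (suc m)
... | suc j | _ | Mℓ≤n | n<M with (suc m ∸ M (suc j)) ≟ 0
... | yes r≡0 = step-∸ Mℓ≤n n<M (subst (λ r → Expansion r []) (sym r≡0) [])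
... | no _ with (suc m ∸ M (suc j)) ≟ M (suc j)
...   | yes r≡M = step-∸ Mℓ≤n n<M (step (trans r≡M (sym (+-identityʳ _))) z≤n [])
...   | no _    = step-∸ Mℓ≤n n<M (expandF-Expansion f _ r≤f)
  where
  r≤f : suc m ∸ M (suc j) ≤ f
  r≤f = ≤-trans (∸-monoʳ-≤ (suc m) (M-mono-≤ {1} {suc j} (s≤s z≤n))) m≤f

count : ℕ → List ℕ → ℕ
count k xs = length (filter (_≟ k) xs)

count-∷ : ∀ k x xs → count k (x ∷ xs) ≡ count k [ x ] + count k xs
count-∷ k x xs with does (x ≟ k)
... | true  = refl
... | false = refl

count-[x]-≢ : ∀ {k x} → x ≢ k → count k [ x ] ≡ 0
count-[x]-≢ {k} x≢k = cong length (filter-reject (_≟ k) x≢k)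

sum-map-0 : ∀ (xs : List ℕ) → sum (map (λ _ → 0) xs) ≡ 0
sum-map-0 []       = refl
sum-map-0 (x ∷ xs) = sum-map-0 xs

sum-map-+ : ∀ (f g : ℕ → ℕ) xs → sum (map (λ i → f i + g i) xs) ≡ sum (map f xs) + sum (map g xs)
sum-map-+ f g []       = refl
sum-map-+ f g (x ∷ xs) = begin
  f x + g x + sum (map (λ i → f i + g i) xs)        ≡⟨ cong (f x + g x +_) (sum-map-+ f g xs) ⟩
  f x + g x + (sum (map f xs) + sum (map g xs))     ≡⟨ +-+-interchange (f x) (g x) _ _ ⟩
  f x + sum (map f xs) + (g x + sum (map g xs))     ∎
  where
  +-+-interchange : ∀ a b c d → a + b + (c + d) ≡ a + c + (b + d)
  +-+-interchange = solve-∀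

sum-map-upTo-suc : ∀ (f : ℕ → ℕ) ℓ → sum (map f (upTo (suc ℓ))) ≡ sum (map f (upTo ℓ)) + f ℓ
sum-map-upTo-suc f ℓ = begin
  sum (map f (upTo (suc ℓ)))          ≡⟨ cong (sum ∘ map f) (sym (upTo-∷ʳ ℓ)) ⟩
  sum (map f (upTo ℓ ++ [ ℓ ]))       ≡⟨ cong sum (map-++ f (upTo ℓ) [ ℓ ]) ⟩
  sum (map f (upTo ℓ) ++ [ f ℓ ])     ≡⟨ sum-++ (map f (upTo ℓ)) [ f ℓ ] ⟩
  sum (map f (upTo ℓ)) + (f ℓ + 0)    ≡⟨ cong (sum (map f (upTo ℓ)) +_) (+-identityʳ (f ℓ)) ⟩
  sum (map f (upTo ℓ)) + f ℓ          ∎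

sum-count-[x]-< : ∀ {x} ℓ → ℓ < x → sum (map (λ i → count (suc i) [ x ]) (upTo ℓ)) ≡ 0
sum-count-[x]-< zero    _   = refl
sum-count-[x]-< {x} (suc ℓ) 1+ℓ<x = begin
  sum (map (λ i → count (suc i) [ x ]) (upTo (suc ℓ)))     ≡⟨ sum-map-upTo-suc (λ i → count (suc i) [ x ]) ℓ ⟩
  sum (map (λ i → count (suc i) [ x ]) (upTo ℓ)) + count (suc ℓ) [ x ]
    ≡⟨ cong₂ _+_ (sum-count-[x]-< ℓ (<-trans (n<1+n ℓ) 1+ℓ<x)) (count-[x]-≢ (≢-sym (<⇒≢ 1+ℓ<x))) ⟩
  0                                                         ∎

sum-count-[x] : ∀ {x} ℓ → 1 ≤ x → x ≤ ℓ → sum (map (λ i → count (suc i) [ x ]) (upTo ℓ)) ≡ 1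
sum-count-[x] zero    (s≤s _) ()
sum-count-[x] {x} (suc ℓ) 1≤x x≤1+ℓ =
  trans (sum-map-upTo-suc (λ i → count (suc i) [ x ]) ℓ) (last-term (m≤n⇒m<n∨m≡n x≤1+ℓ))
  where
  last-term : x < suc ℓ ⊎ x ≡ suc ℓ →
              sum (map (λ i → count (suc i) [ x ]) (upTo ℓ)) + count (suc ℓ) [ x ] ≡ 1
  last-term (inj₁ x<1+ℓ) =
    cong₂ _+_ (sum-count-[x] ℓ 1≤x (s≤s⁻¹ x<1+ℓ)) (count-[x]-≢ (<⇒≢ x<1+ℓ))
  last-term (inj₂ refl) =
    cong₂ _+_ (sum-count-[x]-< ℓ ≤-refl) (cong length (filter-accept (_≟ x) refl))

sum-count : ∀ ℓ xs → All (λ x → 1 ≤ x × x ≤ ℓ) xs →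
  sum (map (λ i → count (suc i) xs) (upTo ℓ)) ≡ length xs
sum-count ℓ [] [] = sum-map-0 (upTo ℓ)
sum-count ℓ (x ∷ xs) ((1≤x , x≤ℓ) ∷ bounds) = begin
  sum (map (λ i → count (suc i) (x ∷ xs)) (upTo ℓ))
    ≡⟨ cong sum (map-cong (λ i → count-∷ (suc i) x xs) (upTo ℓ)) ⟩
  sum (map (λ i → count (suc i) [ x ] + count (suc i) xs) (upTo ℓ))
    ≡⟨ sum-map-+ (λ i → count (suc i) [ x ]) (λ i → count (suc i) xs) (upTo ℓ) ⟩
  sum (map (λ i → count (suc i) [ x ]) (upTo ℓ)) + sum (map (λ i → count (suc i) xs) (upTo ℓ))
    ≡⟨ cong₂ _+_ (sum-count-[x] ℓ 1≤x x≤ℓ) (sum-count ℓ xs bounds) ⟩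
  suc (length xs) ∎

σ-Expansion : ∀ {n} → Expansion n (expand n) → σ n ≡ length (expand n)
σ-Expansion {n} e = sum-count (ell n) (expand n) (All.map (map₂ ≤-ell) (Expansion-bounds e))

lemma2p2 : (n : ℕ) → s (suc n) ≡ 3 * suc n + 2 * σ (suc n)
lemma2p2 n = begin
  s (suc n)                                 ≡⟨ s-Expansion e ⟩
  3 * suc n + 2 * length (expand (suc n))   ≡⟨ cong (λ k → 3 * suc n + 2 * k) (sym (σ-Expansion e)) ⟩
  3 * suc n + 2 * σ (suc n)                 ∎
  where
  e : Expansion (suc n) (expand (suc n))
  e = expandF-Expansion (suc n) (suc n) ≤-refl
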